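{- Let $p$ be a prime, $n\ge2$, and let $A,A'\subseteq\mathbb F_p^n$. Consider $A$ under a decomposition $(v,K)$ and $A'$ under a decomposition $(v',K')$. Suppose $\max_{i\in\mathbb F_p}|A_i|=p^{n-1}$ (for $A$ with respect to $(v,K)$) and $\omega(A')<p$ (with respect to $(v',K')$). If $f(A)\subseteq A'$ for some automorphism $f$ of the additive group $\mathbb F_p^n$, then $s\cdot\mathrm{Supp}(A)\subseteq\mathrm{Supp}(A')$ for some $s\in\mathbb F_p$.
   Context: A decomposition of $\mathbb F_p^n$ is a pair $(v,K)$ where $K$ is a linear subspace of dimension $n-1$ and $v\notin K$. For $X\subseteq\mathbb F_p^n$ and a decomposition $(v,K)$, put $X_i=(X-iv)\cap K$ for $i\in\mathbb F_p$, $\mathrm{Supp}(X)=\{i\in\mathbb F_p: X_i\ne\emptyset\}$, and $\omega(X)=|\mathrm{Supp}(X)|$. For $s\in\mathbb F_p$ and $S\subseteq\mathbb F_p$, $s\cdot S=\{sx:x\in S\}$. -}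

module Defs where

open import Data.Nat using (ℕ; zero; suc; _∸_; _⊔_; NonZero)
import Data.Nat as ℕ
open import Data.Nat.DivMod using (_mod_)
open import Data.Fin using (Fin; toℕ; fromℕ<)
import Data.Fin as Fin
open import Data.Bool using (Bool; true; false; _∧_)
open import Data.Bool.ListAction using (any)
open import Data.Vec using (Vec; []; _∷_; zipWith; replicate; map)
open import Data.List using (List; length; filterᵇ; concatMap; foldr; allFin)
import Data.List as List
open import Data.Product using (Σ; _×_; _,_)
open import Relation.Binary.PropositionalEquality using (_≡_)
open import Function.Definitions using (Bijective)

𝔽 : ℕ → Set
𝔽 p = Fin p

module _ {p : ℕ} {{_ : NonZero p}} where

  _+𝔽_ : 𝔽 p → 𝔽 p → 𝔽 p
  a +𝔽 b = (toℕ a ℕ.+ toℕ b) mod p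

  _*𝔽_ : 𝔽 p → 𝔽 p → 𝔽 p
  a *𝔽 b = (toℕ a ℕ.* toℕ b) mod p

  0𝔽 : 𝔽 p
  0𝔽 = 0 mod p

V : ℕ → ℕ → Set
V p n = Vec (𝔽 p) n

module _ {p : ℕ} {{_ : NonZero p}} {n : ℕ} where

  _+V_ : V p n → V p n → V p n
  _+V_ = zipWith _+𝔽_

  _·V_ : 𝔽 p → V p n → V p n
  c ·V x = map (c *𝔽_) x

  0V : V p n
  0V = replicate n 0𝔽

  lincomb : {m : ℕ} → Vec (𝔽 p) m → Vec (V p n) m → V p n
  lincomb [] [] = 0V
  lincomb (c ∷ cs) (b ∷ bs) = (c ·V b) +V lincomb cs bs

SubsetV : ℕ → ℕ → Set
SubsetV p n = V p n → Bool

allV : (p n : ℕ) → List (V p n)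
allV p zero = [] List.∷ List.[]
allV p (suc n) = concatMap (λ a → List.map (a ∷_) (allV p n)) (allFin p)

module _ {p : ℕ} {{_ : NonZero p}} {n : ℕ} where

  LinIndep : {m : ℕ} → Vec (V p n) m → Set
  LinIndep {m} b = (c : Vec (𝔽 p) m) → lincomb c b ≡ 0V → c ≡ replicate m 0𝔽

  SpanIs : {m : ℕ} → Vec (V p n) m → SubsetV p n → Set
  SpanIs {m} b K = (x : V p n) → (K x ≡ true → Σ (Vec (𝔽 p) m) λ c → lincomb c b ≡ x)
                                × ((c : Vec (𝔽 p) m) → lincomb c b ≡ x → K x ≡ true)

  SubspaceOfDim : ℕ → SubsetV p n → Set
  SubspaceOfDim d K = Σ (Vec (V p n) d) λ b → LinIndep b × SpanIs b K

  Decomposition : V p n → SubsetV p n → Set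
  Decomposition v K = SubspaceOfDim (n ∸ 1) K × K v ≡ false

  -- X_i = (X - i v) ∩ K, as a Bool predicate
  slice : SubsetV p n → V p n → SubsetV p n → 𝔽 p → SubsetV p n
  slice X v K i k = K k ∧ X (k +V (i ·V v))

  sliceSize : SubsetV p n → V p n → SubsetV p n → 𝔽 p → ℕ
  sliceSize X v K i = length (filterᵇ (slice X v K i) (allV p n))

  maxSlice : SubsetV p n → V p n → SubsetV p n → ℕ
  maxSlice X v K = foldr _⊔_ 0 (List.map (sliceSize X v K) (allFin p))

  inSupp : SubsetV p n → V p n → SubsetV p n → 𝔽 p → Bool
  inSupp X v K i = any (slice X v K i) (allV p n)

  ω : SubsetV p n → V p n → SubsetV p n → ℕ
  ω X v K = length (filterᵇ (inSupp X v K) (allFin p))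

  IsAddAut : (V p n → V p n) → Set
  IsAddAut f = Bijective _≡_ _≡_ f × ((x y : V p n) → f (x +V y) ≡ f x +V f y)

{-# OPTIONS --safe #-}
module Submission where

-- Since K has only p^(n-1) elements, a slice of A of that size is a whole coset K + i₀v ⊆ A.
-- Additive maps of 𝔽_p-vector spaces are 𝔽_p-linear, and v' together with a basis of K' is a
-- basis, so f v = s v' + k₀ with k₀ ∈ K'. If some k ∈ K had f k = t v' + k₁ with t ≠ 0, then
-- solving c t + i₀ s = j shows that f(c k + i₀ v) ∈ A' lies in the coset j v' + K' for every j,
-- i.e. ω(A') = p. Hence f(K) ⊆ K', and for x ∈ K with x + i v ∈ A the image
-- f(x + i v) = (f x + i k₀) + (s i) v' puts s i into Supp(A').

open import Algebra.Bundles using (AbelianGroup; CommutativeRing)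
open import Algebra.Consequences.Propositional using (comm∧idˡ⇒idʳ; comm∧invˡ⇒invʳ; comm∧distrˡ⇒distrʳ)
import Algebra.Definitions.RawMonoid as RawMonoidDefinitions
import Algebra.Properties.AbelianGroup as AbelianGroupProperties
import Algebra.Properties.CommutativeSemigroup as CommutativeSemigroupProperties
import Algebra.Properties.Ring as RingProperties
open import Algebra.Structures using (IsAbelianGroup; IsCommutativeRing)
open import Data.Bool using (true; false; _∧_)
open import Data.Bool.Properties using (T-≡; ∧-conicalˡ; ∧-conicalʳ)
import Data.Fin as Fin
open import Data.Fin using (toℕ)
open import Data.Fin.Properties using (toℕ-fromℕ<; toℕ-injective; toℕ<n)
open import Data.List as List using (List; []; _∷_; _++_; length; allFin; cartesianProductWith; concatMap; filterᵇ)
open import Data.List.Membership.Propositional using (_∈_; lose)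
import Data.List.Membership.DecPropositional as DecMembership
open import Data.List.Membership.Propositional.Properties
  using ( ∈-∃++; ∈-++⁻; ∈-++⁺ˡ; ∈-++⁺ʳ; ∈-map⁺; ∈-map⁻; ∈-allFin; ∈-cartesianProductWith⁺; ∈-filter⁻
        ; foldr-selective)
open import Data.List.Properties using (length-++; length-++-sucʳ; length-map; length-tabulate; filter-all)
open import Data.List.Relation.Binary.Subset.Propositional using (_⊆_)
import Data.List.Relation.Unary.All as All
open import Data.List.Relation.Unary.All.Properties using (¬Any⇒All¬)
open import Data.List.Relation.Unary.AllPairs using ([]; _∷_)
open import Data.List.Relation.Unary.Any using (here; there; satisfied)
open import Data.List.Relation.Unary.Any.Properties using (any⁺; any⁻)
open import Data.List.Relation.Unary.Unique.Propositional using (Unique)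
open import Data.List.Relation.Unary.Unique.Propositional.Properties
  using (map⁺; allFin⁺; cartesianProductWith⁺; filter⁺)
open import Data.Nat as ℕ using (ℕ; zero; suc; _≤_; _<_; _^_; _∸_; _%_; NonZero; z≤n; s≤s)
open import Data.Nat.DivMod using (_mod_; %-distribˡ-+; %-distribˡ-*; m<n⇒m%n≡m; n%n≡0)
open import Data.Nat.Divisibility using (_∣_; n∣m⇒m%n≡0; m%n≡0⇒n∣m)
open import Data.Nat.Primality using (Prime; euclidsLemma)
import Data.Nat.Properties as ℕ
open import Data.Product using (Σ; ∃-syntax; _×_; _,_; proj₁; proj₂)
open import Data.Sum as Sum using (_⊎_; inj₁; inj₂)
open import Data.Vec using (Vec; []; _∷_; map; head)
open import Data.Vec.Properties using (∷-injective; ≡-dec)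
open import Data.Vec.Relation.Binary.Pointwise.Inductive
  using (Pointwise-≡⇒≡; zipWith-assoc; zipWith-comm; zipWith-identityˡ)
open import Function.Base using (_∘_)
open import Function.Bundles using (_⇔_; mk⇔; Equivalence)
open import Function.Definitions using (Injective; StrictlySurjective)
open import Level using (0ℓ)
open import Relation.Binary.Definitions using (DecidableEquality)
open import Relation.Binary.PropositionalEquality
open import Relation.Nullary using (yes; no; contradiction)
open import Relation.Nullary.Decidable using (T?)

open import Defs

open Equivalence using (to; from)

private
  variable
    m n : ℕ

-- Counting in finite enumerations

module _ {A : Set} where

  unique⊆⇒length≤ : {xs ys : List A} → Unique xs → xs ⊆ ys → length xs ≤ length ys
  unique⊆⇒length≤ {[]}     _           _     = z≤n
  unique⊆⇒length≤ {x ∷ xs} (x∉xs ∷ xs!) xs⊆ys with as , bs , refl ← ∈-∃++ (xs⊆ys (here refl)) =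
    subst (suc (length xs) ≤_) (sym (length-++-sucʳ as x bs)) (s≤s (unique⊆⇒length≤ xs! xs⊆as++bs))
    where
    xs⊆as++bs : xs ⊆ as ++ bs
    xs⊆as++bs z∈xs with ∈-++⁻ as (xs⊆ys (there z∈xs))
    ... | inj₁ z∈as         = ∈-++⁺ˡ z∈as
    ... | inj₂ (here refl)  = contradiction refl (All.lookup x∉xs z∈xs)
    ... | inj₂ (there z∈bs) = ∈-++⁺ʳ as z∈bs

  unique⊆∧length≥⇒⊇ : DecidableEquality A → {xs ys : List A} →
                       Unique xs → xs ⊆ ys → length ys ≤ length xs → ys ⊆ xs
  unique⊆∧length≥⇒⊇ _≟_ {xs} xs! xs⊆ys ys≤xs {y} y∈ys with y ∈? xs
    where open DecMembership _≟_ using (_∈?_)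
  ... | yes y∈xs = y∈xs
  ... | no  y∉xs = contradiction (unique⊆⇒length≤ (¬Any⇒All¬ xs y∉xs ∷ xs!) y∷xs⊆ys) (ℕ.≤⇒≯ ys≤xs)
    where
    y∷xs⊆ys : y ∷ xs ⊆ _
    y∷xs⊆ys (here refl)  = y∈ys
    y∷xs⊆ys (there z∈xs) = xs⊆ys z∈xs

  injective⇒strictlySurjective : DecidableEquality A → {xs : List A} → Unique xs → (∀ x → x ∈ xs) →
                                 {f : A → A} → Injective _≡_ _≡_ f → StrictlySurjective _≡_ f
  injective⇒strictlySurjective _≟_ {xs} xs! complete {f} f-inj y
    with x , _ , y≡fx ← ∈-map⁻ f (unique⊆∧length≥⇒⊇ _≟_ (map⁺ f-inj xs!) (λ _ → complete _)
                                   (ℕ.≤-reflexive (sym (length-map f xs))) (complete y))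
    = x , sym y≡fx

module _ {A B C : Set} (f : A → B → C) where

  concatMap-map≡cartesianProductWith : ∀ xs ys →
                                       concatMap (λ x → List.map (f x) ys) xs ≡ cartesianProductWith f xs ys
  concatMap-map≡cartesianProductWith []       ys = refl
  concatMap-map≡cartesianProductWith (x ∷ xs) ys =
    cong (List.map (f x) ys ++_) (concatMap-map≡cartesianProductWith xs ys)

  length-cartesianProductWith : ∀ xs ys → length (cartesianProductWith f xs ys) ≡ length xs ℕ.* length ys
  length-cartesianProductWith []       ys = refl
  length-cartesianProductWith (x ∷ xs) ys =
    trans (length-++ (List.map (f x) ys)) (cong₂ ℕ._+_ (length-map (f x) ys) (length-cartesianProductWith xs ys))

module _ {p : ℕ} where

  allV-suc : allV p (suc n) ≡ cartesianProductWith _∷_ (allFin p) (allV p n)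
  allV-suc {n} = concatMap-map≡cartesianProductWith _∷_ (allFin p) (allV p n)

  allV-complete : (x : V p n) → x ∈ allV p n
  allV-complete []      = here refl
  allV-complete (a ∷ x) =
    subst (_ ∈_) (sym allV-suc) (∈-cartesianProductWith⁺ _∷_ (∈-allFin a) (allV-complete x))

  allV-unique : ∀ n → Unique (allV p n)
  allV-unique zero    = All.[] ∷ []
  allV-unique (suc n) =
    subst Unique (sym allV-suc) (cartesianProductWith⁺ _∷_ ∷-injective (allFin⁺ p) (allV-unique n))

  length-allV : ∀ n → length (allV p n) ≡ p ^ n
  length-allV zero    = refl
  length-allV (suc n) = begin
    length (allV p (suc n))                                 ≡⟨ cong length allV-suc ⟩
    length (cartesianProductWith _∷_ (allFin p) (allV p n)) ≡⟨ length-cartesianProductWith _∷_ (allFin p) _ ⟩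
    length (allFin p) ℕ.* length (allV p n)                 ≡⟨ cong₂ ℕ._*_ (length-tabulate {n = p} (λ i → i))
                                                                            (length-allV n) ⟩
    p ℕ.* p ^ n                                             ∎
    where open ≡-Reasoning

-- The field 𝔽 p

isAbelianGroup-≡ : {A : Set} {_∙_ : A → A → A} {ε : A} {_⁻¹ : A → A} →
                   (∀ x y z → (x ∙ y) ∙ z ≡ x ∙ (y ∙ z)) → (∀ x → ε ∙ x ≡ x) →
                   (∀ x → (x ⁻¹) ∙ x ≡ ε) → (∀ x y → x ∙ y ≡ y ∙ x) →
                   IsAbelianGroup _≡_ _∙_ ε _⁻¹
isAbelianGroup-≡ {_∙_ = _∙_} {_⁻¹ = _⁻¹} assoc identityˡ inverseˡ comm = record
  { isGroup = record
    { isMonoid = record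
      { isSemigroup = record
        { isMagma = record { isEquivalence = isEquivalence ; ∙-cong = cong₂ _∙_ }
        ; assoc = assoc }
      ; identity = identityˡ , comm∧idˡ⇒idʳ comm identityˡ }
    ; inverse = inverseˡ , comm∧invˡ⇒invʳ comm inverseˡ
    ; ⁻¹-cong = cong _⁻¹ }
  ; comm = comm }

module _ {p : ℕ} {{_ : NonZero p}} where

  open ≡-Reasoning

  toℕ-mod : ∀ k → toℕ (k mod p) ≡ k % p
  toℕ-mod k = toℕ-fromℕ< _

  mod-toℕ : ∀ (a : 𝔽 p) → toℕ a mod p ≡ a
  mod-toℕ a = toℕ-injective (trans (toℕ-mod (toℕ a)) (m<n⇒m%n≡m (toℕ<n a)))

  %-≡⇒mod-≡ : ∀ {k l} → k % p ≡ l % p → k mod p ≡ l mod p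
  %-≡⇒mod-≡ {k} {l} eq = toℕ-injective (trans (toℕ-mod k) (trans eq (sym (toℕ-mod l))))

  toℕ-0𝔽 : toℕ (0𝔽 {p}) ≡ 0
  toℕ-0𝔽 = trans (toℕ-mod 0) (m<n⇒m%n≡m (ℕ.>-nonZero⁻¹ p))

  mod-+-homo : ∀ k l → (k mod p) +𝔽 (l mod p) ≡ (k ℕ.+ l) mod p
  mod-+-homo k l = %-≡⇒mod-≡ (begin
    (toℕ (k mod p) ℕ.+ toℕ (l mod p)) % p ≡⟨ cong₂ (λ x y → (x ℕ.+ y) % p) (toℕ-mod k) (toℕ-mod l) ⟩
    (k % p ℕ.+ l % p) % p                 ≡⟨ %-distribˡ-+ k l p ⟨
    (k ℕ.+ l) % p                         ∎)

  mod-*-homo : ∀ k l → (k mod p) *𝔽 (l mod p) ≡ (k ℕ.* l) mod p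
  mod-*-homo k l = %-≡⇒mod-≡ (begin
    (toℕ (k mod p) ℕ.* toℕ (l mod p)) % p ≡⟨ cong₂ (λ x y → (x ℕ.* y) % p) (toℕ-mod k) (toℕ-mod l) ⟩
    (k % p ℕ.* (l % p)) % p               ≡⟨ %-distribˡ-* k l p ⟨
    (k ℕ.* l) % p                         ∎)

  1𝔽 : 𝔽 p
  1𝔽 = 1 mod p

  -𝔽_ : 𝔽 p → 𝔽 p
  -𝔽 a = (p ∸ toℕ a) mod p

  +𝔽-assoc : ∀ a b c → (a +𝔽 b) +𝔽 c ≡ a +𝔽 (b +𝔽 c)
  +𝔽-assoc a b c = begin
    (a +𝔽 b) +𝔽 c                       ≡⟨ cong ((a +𝔽 b) +𝔽_) (mod-toℕ c) ⟨
    (a +𝔽 b) +𝔽 (toℕ c mod p)           ≡⟨ mod-+-homo (toℕ a ℕ.+ toℕ b) (toℕ c) ⟩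
    (toℕ a ℕ.+ toℕ b ℕ.+ toℕ c) mod p   ≡⟨ cong (_mod p) (ℕ.+-assoc (toℕ a) (toℕ b) (toℕ c)) ⟩
    (toℕ a ℕ.+ (toℕ b ℕ.+ toℕ c)) mod p ≡⟨ mod-+-homo (toℕ a) (toℕ b ℕ.+ toℕ c) ⟨
    (toℕ a mod p) +𝔽 (b +𝔽 c)           ≡⟨ cong (_+𝔽 (b +𝔽 c)) (mod-toℕ a) ⟩
    a +𝔽 (b +𝔽 c)                       ∎

  *𝔽-assoc : ∀ a b c → (a *𝔽 b) *𝔽 c ≡ a *𝔽 (b *𝔽 c)
  *𝔽-assoc a b c = begin
    (a *𝔽 b) *𝔽 c                       ≡⟨ cong ((a *𝔽 b) *𝔽_) (mod-toℕ c) ⟨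
    (a *𝔽 b) *𝔽 (toℕ c mod p)           ≡⟨ mod-*-homo (toℕ a ℕ.* toℕ b) (toℕ c) ⟩
    (toℕ a ℕ.* toℕ b ℕ.* toℕ c) mod p   ≡⟨ cong (_mod p) (ℕ.*-assoc (toℕ a) (toℕ b) (toℕ c)) ⟩
    (toℕ a ℕ.* (toℕ b ℕ.* toℕ c)) mod p ≡⟨ mod-*-homo (toℕ a) (toℕ b ℕ.* toℕ c) ⟨
    (toℕ a mod p) *𝔽 (b *𝔽 c)           ≡⟨ cong (_*𝔽 (b *𝔽 c)) (mod-toℕ a) ⟩
    a *𝔽 (b *𝔽 c)                       ∎

  +𝔽-comm : ∀ a b → a +𝔽 b ≡ b +𝔽 a
  +𝔽-comm a b = cong (_mod p) (ℕ.+-comm (toℕ a) (toℕ b))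

  *𝔽-comm : ∀ a b → a *𝔽 b ≡ b *𝔽 a
  *𝔽-comm a b = cong (_mod p) (ℕ.*-comm (toℕ a) (toℕ b))

  +𝔽-identityˡ : ∀ a → 0𝔽 +𝔽 a ≡ a
  +𝔽-identityˡ a = begin
    0𝔽 +𝔽 a             ≡⟨ cong (0𝔽 +𝔽_) (mod-toℕ a) ⟨
    0𝔽 +𝔽 (toℕ a mod p) ≡⟨ mod-+-homo 0 (toℕ a) ⟩
    toℕ a mod p         ≡⟨ mod-toℕ a ⟩
    a                   ∎

  *𝔽-identityˡ : ∀ a → 1𝔽 *𝔽 a ≡ a
  *𝔽-identityˡ a = begin
    1𝔽 *𝔽 a             ≡⟨ cong (1𝔽 *𝔽_) (mod-toℕ a) ⟨
    1𝔽 *𝔽 (toℕ a mod p) ≡⟨ mod-*-homo 1 (toℕ a) ⟩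
    (1 ℕ.* toℕ a) mod p ≡⟨ cong (_mod p) (ℕ.*-identityˡ (toℕ a)) ⟩
    toℕ a mod p         ≡⟨ mod-toℕ a ⟩
    a                   ∎

  -𝔽-inverseˡ : ∀ a → (-𝔽 a) +𝔽 a ≡ 0𝔽
  -𝔽-inverseˡ a = begin
    (-𝔽 a) +𝔽 a                 ≡⟨ cong ((-𝔽 a) +𝔽_) (mod-toℕ a) ⟨
    (-𝔽 a) +𝔽 (toℕ a mod p)     ≡⟨ mod-+-homo (p ∸ toℕ a) (toℕ a) ⟩
    (p ∸ toℕ a ℕ.+ toℕ a) mod p ≡⟨ cong (_mod p) (ℕ.m∸n+n≡m (ℕ.<⇒≤ (toℕ<n a))) ⟩
    p mod p                     ≡⟨ toℕ-injective (trans (toℕ-mod p) (trans (n%n≡0 p) (sym toℕ-0𝔽))) ⟩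
    0𝔽                          ∎

  *𝔽-distribˡ-+𝔽 : ∀ a b c → a *𝔽 (b +𝔽 c) ≡ (a *𝔽 b) +𝔽 (a *𝔽 c)
  *𝔽-distribˡ-+𝔽 a b c = begin
    a *𝔽 (b +𝔽 c)                               ≡⟨ cong (_*𝔽 (b +𝔽 c)) (mod-toℕ a) ⟨
    (toℕ a mod p) *𝔽 (b +𝔽 c)                   ≡⟨ mod-*-homo (toℕ a) (toℕ b ℕ.+ toℕ c) ⟩
    (toℕ a ℕ.* (toℕ b ℕ.+ toℕ c)) mod p         ≡⟨ cong (_mod p) (ℕ.*-distribˡ-+ (toℕ a) (toℕ b) (toℕ c)) ⟩
    (toℕ a ℕ.* toℕ b ℕ.+ toℕ a ℕ.* toℕ c) mod p ≡⟨ mod-+-homo (toℕ a ℕ.* toℕ b) (toℕ a ℕ.* toℕ c) ⟨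
    (a *𝔽 b) +𝔽 (a *𝔽 c)                        ∎

  𝔽-isCommutativeRing : IsCommutativeRing _≡_ _+𝔽_ _*𝔽_ -𝔽_ 0𝔽 1𝔽
  𝔽-isCommutativeRing = record
    { isRing = record
      { +-isAbelianGroup = isAbelianGroup-≡ +𝔽-assoc +𝔽-identityˡ -𝔽-inverseˡ +𝔽-comm
      ; *-cong           = cong₂ _*𝔽_
      ; *-assoc          = *𝔽-assoc
      ; *-identity       = *𝔽-identityˡ , comm∧idˡ⇒idʳ *𝔽-comm *𝔽-identityˡ
      ; distrib          = *𝔽-distribˡ-+𝔽 , comm∧distrˡ⇒distrʳ *𝔽-comm *𝔽-distribˡ-+𝔽 }
    ; *-comm = *𝔽-comm }

  𝔽-commutativeRing : CommutativeRing 0ℓ 0ℓ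
  𝔽-commutativeRing = record { isCommutativeRing = 𝔽-isCommutativeRing }

  private
    module 𝔽 = CommutativeRing 𝔽-commutativeRing
    module 𝔽ᴾ = RingProperties 𝔽.ring

  module _ (p-prime : Prime p) where

    ∣toℕ⇒≡0𝔽 : ∀ {a : 𝔽 p} → p ∣ toℕ a → a ≡ 0𝔽
    ∣toℕ⇒≡0𝔽 {a} p∣a = toℕ-injective (begin
      toℕ a     ≡⟨ m<n⇒m%n≡m (toℕ<n a) ⟨
      toℕ a % p ≡⟨ n∣m⇒m%n≡0 (toℕ a) p p∣a ⟩
      0         ≡⟨ toℕ-0𝔽 ⟨
      toℕ 0𝔽    ∎)

    *𝔽-noZeroDivisors : ∀ {a b : 𝔽 p} → a *𝔽 b ≡ 0𝔽 → a ≡ 0𝔽 ⊎ b ≡ 0𝔽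
    *𝔽-noZeroDivisors {a} {b} ab≡0 =
      Sum.map ∣toℕ⇒≡0𝔽 ∣toℕ⇒≡0𝔽 (euclidsLemma (toℕ a) (toℕ b) p-prime (m%n≡0⇒n∣m _ p ab%p≡0))
      where
      ab%p≡0 : (toℕ a ℕ.* toℕ b) % p ≡ 0
      ab%p≡0 = trans (sym (toℕ-mod _)) (trans (cong toℕ ab≡0) toℕ-0𝔽)

    *𝔽-cancelʳ : ∀ {t} → t ≢ 0𝔽 → ∀ {c d} → c *𝔽 t ≡ d *𝔽 t → c ≡ d
    *𝔽-cancelʳ {t} t≢0 {c} {d} ct≡dt with *𝔽-noZeroDivisors [c-d]t≡0
      where
      [c-d]t≡0 : (c 𝔽.- d) *𝔽 t ≡ 0𝔽
      [c-d]t≡0 = trans (𝔽ᴾ.[y-z]x≈yx-zx t c d) (𝔽ᴾ.x≈y⇒x∙y⁻¹≈ε ct≡dt)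
    ... | inj₁ c-d≡0 = 𝔽ᴾ.x∙y⁻¹≈ε⇒x≈y c d c-d≡0
    ... | inj₂ t≡0   = contradiction t≡0 t≢0

    *𝔽-surjective : ∀ {t} → t ≢ 0𝔽 → StrictlySurjective _≡_ (_*𝔽 t)
    *𝔽-surjective t≢0 = injective⇒strictlySurjective Fin._≟_ (allFin⁺ p) ∈-allFin (*𝔽-cancelʳ t≢0)

    *𝔽-+𝔽-solvable : ∀ {t} → t ≢ 0𝔽 → ∀ a j → ∃[ c ] (c *𝔽 t) +𝔽 a ≡ j
    *𝔽-+𝔽-solvable t≢0 a j with c , ct≡j-a ← *𝔽-surjective t≢0 (j 𝔽.- a) =
      c , trans (cong (_+𝔽 a) ct≡j-a) (𝔽ᴾ.//-rightDividesˡ a j)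

  -- The vector space V p n

  -V_ : V p n → V p n
  -V_ = map -𝔽_

  +V-assoc : ∀ (x y z : V p n) → (x +V y) +V z ≡ x +V (y +V z)
  +V-assoc x y z = Pointwise-≡⇒≡ (zipWith-assoc 𝔽.+-assoc x y z)

  +V-comm : ∀ (x y : V p n) → x +V y ≡ y +V x
  +V-comm x y = Pointwise-≡⇒≡ (zipWith-comm 𝔽.+-comm x y)

  +V-identityˡ : ∀ (x : V p n) → 0V +V x ≡ x
  +V-identityˡ x = Pointwise-≡⇒≡ (zipWith-identityˡ 𝔽.+-identityˡ x)

  -V-inverseˡ : ∀ (x : V p n) → (-V x) +V x ≡ 0V
  -V-inverseˡ []      = refl
  -V-inverseˡ (a ∷ x) = cong₂ _∷_ (𝔽.-‿inverseˡ a) (-V-inverseˡ x)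

  V-isAbelianGroup : IsAbelianGroup _≡_ (_+V_ {n = n}) 0V -V_
  V-isAbelianGroup = isAbelianGroup-≡ +V-assoc +V-identityˡ -V-inverseˡ +V-comm

  V-abelianGroup : ℕ → AbelianGroup 0ℓ 0ℓ
  V-abelianGroup n = record { isAbelianGroup = V-isAbelianGroup {n} }

  private
    module Vᴳ {n : ℕ} = AbelianGroup (V-abelianGroup n)
    module Vᴾ {n : ℕ} = AbelianGroupProperties (V-abelianGroup n)
    module Vᶜ {n : ℕ} = CommutativeSemigroupProperties (Vᴳ.commutativeSemigroup {n})
    open module Multiples {n : ℕ} = RawMonoidDefinitions (Vᴳ.rawMonoid {n})
      using () renaming (_×_ to _×V_)

  ·V-distribʳ : ∀ c d (x : V p n) → (c +𝔽 d) ·V x ≡ (c ·V x) +V (d ·V x)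
  ·V-distribʳ c d []      = refl
  ·V-distribʳ c d (a ∷ x) = cong₂ _∷_ (𝔽.distribʳ a c d) (·V-distribʳ c d x)

  ·V-assoc : ∀ c d (x : V p n) → (c *𝔽 d) ·V x ≡ c ·V (d ·V x)
  ·V-assoc c d []      = refl
  ·V-assoc c d (a ∷ x) = cong₂ _∷_ (𝔽.*-assoc c d a) (·V-assoc c d x)

  ·V-identityˡ : ∀ (x : V p n) → 1𝔽 ·V x ≡ x
  ·V-identityˡ []      = refl
  ·V-identityˡ (a ∷ x) = cong₂ _∷_ (𝔽.*-identityˡ a) (·V-identityˡ x)

  ·V-zeroˡ : ∀ (x : V p n) → 0𝔽 ·V x ≡ 0V
  ·V-zeroˡ []      = refl
  ·V-zeroˡ (a ∷ x) = cong₂ _∷_ (𝔽.zeroˡ a) (·V-zeroˡ x)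

  mod-·V : ∀ k (x : V p n) → (k mod p) ·V x ≡ k ×V x
  mod-·V zero    x = ·V-zeroˡ x
  mod-·V (suc k) x = begin
    (suc k mod p) ·V x            ≡⟨ cong (_·V x) (mod-+-homo 1 k) ⟨
    (1𝔽 +𝔽 (k mod p)) ·V x        ≡⟨ ·V-distribʳ 1𝔽 (k mod p) x ⟩
    (1𝔽 ·V x) +V ((k mod p) ·V x) ≡⟨ cong₂ _+V_ (·V-identityˡ x) (mod-·V k x) ⟩
    x +V (k ×V x)                 ∎

  Additive : (V p m → V p n) → Set
  Additive g = ∀ x y → g (x +V y) ≡ g x +V g y

  module _ {g : V p m → V p n} (g-+ : Additive g) where

    additive-0V : g 0V ≡ 0V
    additive-0V = Vᴾ.∙-cancelˡ (g 0V) (g 0V) 0V (begin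
      g 0V +V g 0V ≡⟨ g-+ 0V 0V ⟨
      g (0V +V 0V) ≡⟨ cong g (+V-identityˡ 0V) ⟩
      g 0V         ≡⟨ Vᴳ.identityʳ (g 0V) ⟨
      g 0V +V 0V   ∎)

    additive--V : ∀ x → g (-V x) ≡ -V g x
    additive--V x = Vᴾ.inverseˡ-unique (g (-V x)) (g x) (begin
      g (-V x) +V g x ≡⟨ g-+ (-V x) x ⟨
      g ((-V x) +V x) ≡⟨ cong g (-V-inverseˡ x) ⟩
      g 0V            ≡⟨ additive-0V ⟩
      0V              ∎)

    additive-×V : ∀ k x → g (k ×V x) ≡ k ×V g x
    additive-×V zero    x = additive-0V
    additive-×V (suc k) x = trans (g-+ x (k ×V x)) (cong (g x +V_) (additive-×V k x))

    additive⇒linear : ∀ c x → g (c ·V x) ≡ c ·V g x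
    additive⇒linear c x = begin
      g (c ·V x)             ≡⟨ cong (λ a → g (a ·V x)) (mod-toℕ c) ⟨
      g ((toℕ c mod p) ·V x) ≡⟨ cong g (mod-·V (toℕ c) x) ⟩
      g (toℕ c ×V x)         ≡⟨ additive-×V (toℕ c) x ⟩
      toℕ c ×V g x           ≡⟨ mod-·V (toℕ c) (g x) ⟨
      (toℕ c mod p) ·V g x   ≡⟨ cong (_·V g x) (mod-toℕ c) ⟩
      c ·V g x               ∎

  lincomb-+ : ∀ (c d : V p m) (B : Vec (V p n) m) → lincomb (c +V d) B ≡ lincomb c B +V lincomb d B
  lincomb-+ []       []       []      = sym (+V-identityˡ 0V)
  lincomb-+ (c ∷ cs) (d ∷ ds) (b ∷ B) = begin
    ((c +𝔽 d) ·V b) +V lincomb (cs +V ds) B                  ≡⟨ cong₂ _+V_ (·V-distribʳ c d b) (lincomb-+ cs ds B) ⟩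
    ((c ·V b) +V (d ·V b)) +V (lincomb cs B +V lincomb ds B) ≡⟨ Vᶜ.interchange (c ·V b) (d ·V b) _ _ ⟩
    ((c ·V b) +V lincomb cs B) +V ((d ·V b) +V lincomb ds B) ∎

  lincomb-· : ∀ a (c : V p m) (B : Vec (V p n) m) → lincomb (a ·V c) B ≡ a ·V lincomb c B
  lincomb-· a c B = additive⇒linear (λ c d → lincomb-+ c d B) a c

  lincomb--V : ∀ (c : V p m) (B : Vec (V p n) m) → lincomb (-V c) B ≡ -V lincomb c B
  lincomb--V c B = additive--V (λ c d → lincomb-+ c d B) c

  lincomb-0∷ : ∀ (c : V p m) u (B : Vec (V p n) m) → lincomb (0𝔽 ∷ c) (u ∷ B) ≡ lincomb c B
  lincomb-0∷ c u B = trans (cong (_+V lincomb c B) (·V-zeroˡ u)) (+V-identityˡ (lincomb c B))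

  LinIndep⇒lincomb-injective : {B : Vec (V p n) m} → LinIndep B → Injective _≡_ _≡_ (λ c → lincomb c B)
  LinIndep⇒lincomb-injective {B = B} indep {c} {d} eq = Vᴾ.x∙y⁻¹≈ε⇒x≈y c d (indep (c +V (-V d)) (begin
    lincomb (c +V (-V d)) B         ≡⟨ lincomb-+ c (-V d) B ⟩
    lincomb c B +V lincomb (-V d) B ≡⟨ cong (lincomb c B +V_) (lincomb--V d B) ⟩
    lincomb c B +V (-V lincomb d B) ≡⟨ Vᴾ.x≈y⇒x∙y⁻¹≈ε eq ⟩
    0V                              ∎))

  module _ {B : Vec (V p n) m} {K : SubsetV p n} (span : SpanIs B K) where

    span-∋-lincomb : ∀ c → K (lincomb c B) ≡ true
    span-∋-lincomb c = proj₂ (span _) c refl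

    span-· : ∀ a {x} → K x ≡ true → K (a ·V x) ≡ true
    span-· a {x} x∈K with c , refl ← proj₁ (span x) x∈K =
      subst (λ y → K y ≡ true) (lincomb-· a c B) (span-∋-lincomb (a ·V c))

  module _ (p-prime : Prime p) where

    LinIndep-∷ : {B : Vec (V p n) m} {K : SubsetV p n} {v : V p n} →
                 LinIndep B → SpanIs B K → K v ≡ false → LinIndep (v ∷ B)
    LinIndep-∷ {B = B} {K} {v} indep span v∉K (t ∷ c) tv+Bc≡0 with t Fin.≟ 0𝔽
    ... | yes refl = cong (0𝔽 ∷_) (indep c (trans (sym (lincomb-0∷ c v B)) tv+Bc≡0))
    ... | no  t≢0  with u , ut≡1 ← *𝔽-surjective p-prime t≢0 1𝔽 =
      contradiction (trans (sym v∈K) v∉K) λ ()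
      where
      v∈K : K v ≡ true
      v∈K = subst (λ y → K y ≡ true) (sym (begin
        v                       ≡⟨ ·V-identityˡ v ⟨
        1𝔽 ·V v                 ≡⟨ cong (_·V v) ut≡1 ⟨
        (u *𝔽 t) ·V v           ≡⟨ ·V-assoc u t v ⟩
        u ·V (t ·V v)           ≡⟨ cong (u ·V_) (Vᴾ.inverseˡ-unique (t ·V v) (lincomb c B) tv+Bc≡0) ⟩
        u ·V (-V lincomb c B)   ≡⟨ cong (u ·V_) (lincomb--V c B) ⟨
        u ·V lincomb (-V c) B   ≡⟨ lincomb-· u (-V c) B ⟨
        lincomb (u ·V (-V c)) B ∎)) (span-∋-lincomb span (u ·V (-V c)))

    lincomb-∷-surjective : {B : Vec (V p (suc m)) m} {K : SubsetV p (suc m)} {v : V p (suc m)} →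
                           LinIndep B → SpanIs B K → K v ≡ false →
                           StrictlySurjective _≡_ (λ e → lincomb e (v ∷ B))
    lincomb-∷-surjective indep span v∉K =
      injective⇒strictlySurjective (≡-dec Fin._≟_) (allV-unique _) allV-complete
        (LinIndep⇒lincomb-injective (LinIndep-∷ indep span v∉K))

  -- Slices and supports

  module _ (X : SubsetV p n) (v : V p n) (K : SubsetV p n) where

    inSupp⇔ : ∀ i → inSupp X v K i ≡ true ⇔ (∃[ k ] K k ≡ true × X (k +V (i ·V v)) ≡ true)
    inSupp⇔ i = mk⇔ elim intro
      where
      elim : inSupp X v K i ≡ true → ∃[ k ] K k ≡ true × X (k +V (i ·V v)) ≡ true
      elim i∈Supp with k , k∈Xᵢ ← satisfied (any⁻ (slice X v K i) (allV p n) (from T-≡ i∈Supp)) =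
        k , ∧-conicalˡ _ _ (to T-≡ k∈Xᵢ) , ∧-conicalʳ _ _ (to T-≡ k∈Xᵢ)
      intro : ∃[ k ] K k ≡ true × X (k +V (i ·V v)) ≡ true → inSupp X v K i ≡ true
      intro (k , k∈K , k+iv∈X) =
        to T-≡ (any⁺ (slice X v K i) (lose (allV-complete k) (from T-≡ (cong₂ _∧_ k∈K k+iv∈X))))

    all-inSupp⇒ω≡p : (∀ j → inSupp X v K j ≡ true) → ω X v K ≡ p
    all-inSupp⇒ω≡p all-in = begin
      length (filterᵇ (inSupp X v K) (allFin p)) ≡⟨ cong length (filter-all (T? ∘ inSupp X v K) all-in′) ⟩
      length (allFin p)                          ≡⟨ length-tabulate {n = p} (λ j → j) ⟩
      p                                          ∎
      where all-in′ = All.universal (λ j → from T-≡ (all-in j)) (allFin p)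

    maxSlice-attained : 0 < maxSlice X v K → ∃[ i ] sliceSize X v K i ≡ maxSlice X v K
    maxSlice-attained max>0 with foldr-selective ℕ.⊔-sel 0 (List.map (sliceSize X v K) (allFin p))
    ... | inj₁ max≡0   = contradiction max≡0 (ℕ.>⇒≢ max>0)
    ... | inj₂ max∈map with i , _ , max≡ ← ∈-map⁻ (sliceSize X v K) max∈map = i , sym max≡

    sliceSize≡p^m⇒full : {B : Vec (V p n) m} → SpanIs B K → ∀ i → sliceSize X v K i ≡ p ^ m →
                         ∀ {k} → K k ≡ true → X (k +V (i ·V v)) ≡ true
    sliceSize≡p^m⇒full {m} {B} span i size≡ {k} k∈K with c , refl ← proj₁ (span k) k∈K =
      ∧-conicalʳ _ _ (∈Xᵢ⇒inSlice (span⊆Xᵢ (∈-map⁺ _ (allV-complete c))))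
      where
      Xᵢ = filterᵇ (slice X v K i) (allV p n)
      spanList = List.map (λ c → lincomb c B) (allV p m)

      ∈Xᵢ⇒inSlice : ∀ {z} → z ∈ Xᵢ → slice X v K i z ≡ true
      ∈Xᵢ⇒inSlice z∈Xᵢ = to T-≡ (proj₂ (∈-filter⁻ (T? ∘ slice X v K i) {xs = allV p n} z∈Xᵢ))

      Xᵢ⊆span : Xᵢ ⊆ spanList
      Xᵢ⊆span z∈Xᵢ with d , refl ← proj₁ (span _) (∧-conicalˡ _ _ (∈Xᵢ⇒inSlice z∈Xᵢ)) =
        ∈-map⁺ _ (allV-complete d)

      span⊆Xᵢ : spanList ⊆ Xᵢ
      span⊆Xᵢ = unique⊆∧length≥⇒⊇ (≡-dec Fin._≟_) (filter⁺ (T? ∘ slice X v K i) (allV-unique n))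
        Xᵢ⊆span (ℕ.≤-reflexive (begin
          length spanList   ≡⟨ length-map _ (allV p m) ⟩
          length (allV p m) ≡⟨ length-allV m ⟩
          p ^ m             ≡⟨ size≡ ⟨
          length Xᵢ         ∎))

  module SupportTransfer (p-prime : Prime p) {m n : ℕ} {A A' K K' : SubsetV p n} {v v' : V p n}
                         {B B' : Vec (V p n) m} (span : SpanIs B K) (span' : SpanIs B' K')
                         (spans : StrictlySurjective _≡_ (λ e → lincomb e (v' ∷ B')))
                         {f : V p n → V p n} (f-+ : Additive f) (f[A]⊆A' : ∀ x → A x ≡ true → A' (f x) ≡ true)
                         (i₀ : 𝔽 p) (full : ∀ {k} → K k ≡ true → A (k +V (i₀ ·V v)) ≡ true)
                         (ω<p : ω A' v' K' < p) where

    ⟦_⟧ : V p (suc m) → V p n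
    ⟦ e ⟧ = lincomb e (v' ∷ B')

    image-in-Supp : ∀ {x} e → A x ≡ true → f x ≡ ⟦ e ⟧ → inSupp A' v' K' (head e) ≡ true
    image-in-Supp {x} (j ∷ w) x∈A fx≡ = from (inSupp⇔ A' v' K' j)
      (lincomb w B' , span-∋-lincomb span' w ,
       subst (λ y → A' y ≡ true) (trans fx≡ (+V-comm (j ·V v') (lincomb w B'))) (f[A]⊆A' x x∈A))

    module _ {s : 𝔽 p} {w₀ : V p m} (fv≡ : f v ≡ ⟦ s ∷ w₀ ⟧) where

      coords-f[x+i·v] : ∀ {x} e i → f x ≡ ⟦ e ⟧ → f (x +V (i ·V v)) ≡ ⟦ e +V (i ·V (s ∷ w₀)) ⟧
      coords-f[x+i·v] {x} e i fx≡ = begin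
        f (x +V (i ·V v))          ≡⟨ f-+ x (i ·V v) ⟩
        f x +V f (i ·V v)          ≡⟨ cong₂ _+V_ fx≡ (additive⇒linear f-+ i v) ⟩
        ⟦ e ⟧ +V (i ·V f v)        ≡⟨ cong (λ y → ⟦ e ⟧ +V (i ·V y)) fv≡ ⟩
        ⟦ e ⟧ +V (i ·V ⟦ s ∷ w₀ ⟧) ≡⟨ cong (⟦ e ⟧ +V_) (lincomb-· i (s ∷ w₀) (v' ∷ B')) ⟨
        ⟦ e ⟧ +V ⟦ i ·V (s ∷ w₀) ⟧ ≡⟨ lincomb-+ e (i ·V (s ∷ w₀)) (v' ∷ B') ⟨
        ⟦ e +V (i ·V (s ∷ w₀)) ⟧   ∎

      f[K]⊆K' : ∀ {k} → K k ≡ true → K' (f k) ≡ true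
      f[K]⊆K' {k} k∈K with t ∷ w , fk≡ ← spans (f k) with t Fin.≟ 0𝔽
      ... | yes refl =
        subst (λ y → K' y ≡ true) (trans (sym (lincomb-0∷ w v' B')) fk≡) (span-∋-lincomb span' w)
      ... | no  t≢0  = contradiction (all-inSupp⇒ω≡p A' v' K' all-in-Supp) (ℕ.<⇒≢ ω<p)
        where
        all-in-Supp : ∀ j → inSupp A' v' K' j ≡ true
        all-in-Supp j with c , ct+i₀s≡j ← *𝔽-+𝔽-solvable p-prime t≢0 (i₀ *𝔽 s) j =
          subst (λ h → inSupp A' v' K' h ≡ true) ct+i₀s≡j
            (image-in-Supp ((c ·V (t ∷ w)) +V (i₀ ·V (s ∷ w₀))) (full (span-· span c k∈K))
              (coords-f[x+i·v] (c ·V (t ∷ w)) i₀ (begin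
                f (c ·V k)       ≡⟨ additive⇒linear f-+ c k ⟩
                c ·V f k         ≡⟨ cong (c ·V_) fk≡ ⟨
                c ·V ⟦ t ∷ w ⟧   ≡⟨ lincomb-· c (t ∷ w) (v' ∷ B') ⟨
                ⟦ c ·V (t ∷ w) ⟧ ∎)))

      s·Supp⊆Supp' : ∀ i → inSupp A v K i ≡ true → inSupp A' v' K' (s *𝔽 i) ≡ true
      s·Supp⊆Supp' i i∈Supp with x , x∈K , x+iv∈A ← to (inSupp⇔ A v K i) i∈Supp
                            with w , B'w≡fx ← proj₁ (span' (f x)) (f[K]⊆K' x∈K) =
        subst (λ h → inSupp A' v' K' h ≡ true) (trans (𝔽.+-identityˡ (i *𝔽 s)) (𝔽.*-comm i s))
          (image-in-Supp ((0𝔽 ∷ w) +V (i ·V (s ∷ w₀))) x+iv∈A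
            (coords-f[x+i·v] (0𝔽 ∷ w) i (trans (sym B'w≡fx) (sym (lincomb-0∷ w v' B')))))

    ∃s·Supp⊆Supp' : ∃[ s ] ∀ i → inSupp A v K i ≡ true → inSupp A' v' K' (s *𝔽 i) ≡ true
    ∃s·Supp⊆Supp' with s ∷ w₀ , B'sw₀≡fv ← spans (f v) = s , s·Supp⊆Supp' {s} {w₀} (sym B'sw₀≡fv)

lemma2p6 : (p : ℕ) → {{_ : NonZero p}} → Prime p → (n : ℕ) → 2 ≤ n →
    (A A' : SubsetV p n) (v v' : V p n) (K K' : SubsetV p n) →
    Decomposition v K → Decomposition v' K' →
    maxSlice A v K ≡ p ^ (n ∸ 1) →
    ω A' v' K' < p →
    (f : V p n → V p n) → IsAddAut f →
    ((x : V p n) → A x ≡ true → A' (f x) ≡ true) →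
    Σ (𝔽 p) λ s → (i : 𝔽 p) → inSupp A v K i ≡ true → inSupp A' v' K' (s *𝔽 i) ≡ true
lemma2p6 p p-prime (suc m) _ A A' v v' K K' ((B , _ , span) , _) ((B' , indep' , span') , v'∉K')
         max≡ ω<p f (_ , f-+) f[A]⊆A'
  with i₀ , size≡max ← maxSlice-attained A v K (subst (0 <_) (sym max≡) (ℕ.m^n>0 p m)) =
  ∃s·Supp⊆Supp'
  where
  open SupportTransfer p-prime {A = A} {A'} span span' (lincomb-∷-surjective p-prime indep' span' v'∉K')
                       f-+ f[A]⊆A' i₀ (sliceSize≡p^m⇒full A v K span i₀ (trans size≡max max≡)) ω<p
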